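{- Let $k$ be a positive integer and let $G$ be a directed acyclic graph with vertex set $V$, $n=|V|>10k$, such that every induced subgraph of $G$ on $k$ vertices has at least one edge. Then there exist a set $X\subseteq V$ and sets $S_+(u)\subseteq V$ for all $u\in V$ such that: $|X|>\frac{n}{2}$; for all $u\in X$, $|S_+(u)|\ge\frac{n}{3k}$; and for all $u\in V$ and all $x\in S_+(u)$, $u\prec x$. Likewise, there exist a set $X'\subseteq V$ and sets $S_-(u)\subseteq V$ for all $u\in V$ such that $|X'|>\frac{n}{2}$, $|S_-(u)|\ge\frac{n}{3k}$ for all $u\in X'$, and $x\prec u$ for all $u\in V$ and $x\in S_-(u)$.
   Context: For vertices $x,y$ of the directed acyclic graph $G$, $x\prec y$ means that there is a directed path from $x$ to $y$ in $G$. ``Edge'' in the hypothesis on induced subgraphs means an edge in either direction. -}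

module Defs where

open import Data.Nat using (ℕ)
open import Data.Bool using (Bool; true)
open import Data.Fin using (Fin)
open import Data.Fin.Subset using (Subset; _∈_; ∣_∣)
open import Data.Product using (Σ; ∃; _×_)
open import Relation.Binary.PropositionalEquality using (_≡_)
open import Relation.Binary.Construct.Closure.Transitive using (TransClosure)
open import Relation.Nullary using (¬_)

-- A finite directed graph on vertex set Fin n, given by its adjacency
-- matrix: adj u v ≡ true means there is a directed edge u → v.
Digraph : ℕ → Set
Digraph n = Fin n → Fin n → Bool

Edge : ∀ {n} → Digraph n → Fin n → Fin n → Set
Edge G u v = G u v ≡ true

-- x ≺ y : there is a (nonempty) directed path from x to y.
Reach : ∀ {n} → Digraph n → Fin n → Fin n → Set
Reach G = TransClosure (Edge G)

Acyclic : ∀ {n} → Digraph n → Set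
Acyclic G = ∀ v → ¬ Reach G v v

EveryKSetHasEdge : ∀ {n} → Digraph n → ℕ → Set
EveryKSetHasEdge {n} G k =
  (S : Subset n) → ∣ S ∣ ≡ k →
  Σ (Fin n) λ x → Σ (Fin n) λ y → x ∈ S × y ∈ S × Edge G x y

-- A vertex u is heavy if its out-degree is at least n/(3k); X is the set of
-- heavy vertices and S₊ u the out-neighbourhood of u.  If the light vertices
-- were at least half of V, a greedy procedure would find an independent set of
-- k light vertices, contradicting the hypothesis: repeatedly take a source v of
-- the remaining light vertices (it exists by acyclicity), and discard v together
-- with its out-neighbours.  Since v is a source, no later choice is adjacent to
-- it, and each round discards fewer than 1 + n/(3k) vertices, so k rounds fit
-- into n/2 vertices as soon as n ≥ 6k.  The in-version is the out-version for
-- the reversed graph.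
module Submission where

open import Defs
open import Level using (Level)
open import Data.Nat using (ℕ; zero; suc; _*_; _+_; _<_; _≤_; _<′_; ≤′-refl; ≤′-step; z≤n; s≤s; _≤?_; _<?_)
open import Data.Nat.Properties
open import Data.Nat.Tactic.RingSolver using (solve-∀)
open import Data.Bool using (true; false)
import Data.Bool as Bool
open import Data.Fin using (Fin; zero; suc; toℕ)
open import Data.Fin.Properties using (pigeonhole; any?)
open import Data.Fin.Subset
open import Data.Fin.Subset.Properties
open import Data.Vec using (_∷_; []; here; there; tabulate)
open import Data.Vec.Properties using (lookup∘tabulate; []=⇒lookup; lookup⇒[]=)
open import Data.Product using (Σ; ∃; _×_; _,_; proj₁; proj₂)
open import Data.Sum using (inj₁; inj₂)
open import Function using (_∘_)
open import Relation.Nullary using (¬_; yes; no; does; contradiction; ¬?; _×-dec_)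
open import Relation.Unary using (Pred; Decidable)
open import Relation.Nullary.Decidable using (dec-true; decidable-stable)
open import Relation.Binary using (Rel)
open import Relation.Binary.PropositionalEquality
open import Relation.Binary.Construct.Closure.Transitive using (TransClosure; [_]; _∷_; _∷ʳ_)

private
  variable
    ℓ p : Level
    n : ℕ

x∈p─q⇒x∉q : ∀ {x : Fin n} (p q : Subset n) → x ∈ p ─ q → x ∉ q
x∈p─q⇒x∉q (s ∷ p) (false ∷ q) here ()
x∈p─q⇒x∉q (s ∷ p) (t ∷ q) (there x∈p─q) (there x∈q) = x∈p─q⇒x∉q p q x∈p─q x∈q

∣p∣≤∣p─q∣+∣q∣ : ∀ (p q : Subset n) → ∣ p ∣ ≤ ∣ p ─ q ∣ + ∣ q ∣
∣p∣≤∣p─q∣+∣q∣ [] [] = z≤n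
∣p∣≤∣p─q∣+∣q∣ (false ∷ p) (false ∷ q) = ∣p∣≤∣p─q∣+∣q∣ p q
∣p∣≤∣p─q∣+∣q∣ (true ∷ p) (false ∷ q) = s≤s (∣p∣≤∣p─q∣+∣q∣ p q)
∣p∣≤∣p─q∣+∣q∣ (s ∷ p) (true ∷ q) = begin
  ∣ s ∷ p ∣               ≤⟨ ∣x∷p∣≤1+∣p∣ s p ⟩
  suc ∣ p ∣               ≤⟨ s≤s (∣p∣≤∣p─q∣+∣q∣ p q) ⟩
  suc (∣ p ─ q ∣ + ∣ q ∣) ≡⟨ +-suc ∣ p ─ q ∣ ∣ q ∣ ⟨
  ∣ p ─ q ∣ + suc ∣ q ∣   ∎
  where
  open ≤-Reasoning
  ∣x∷p∣≤1+∣p∣ : ∀ s (p : Subset n) → ∣ s ∷ p ∣ ≤ suc ∣ p ∣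
  ∣x∷p∣≤1+∣p∣ true p = ≤-refl
  ∣x∷p∣≤1+∣p∣ false p = n≤1+n ∣ p ∣

∣p∪q∣≤∣p∣+∣q∣ : ∀ (p q : Subset n) → ∣ p ∪ q ∣ ≤ ∣ p ∣ + ∣ q ∣
∣p∪q∣≤∣p∣+∣q∣ [] [] = z≤n
∣p∪q∣≤∣p∣+∣q∣ (false ∷ p) (false ∷ q) = ∣p∪q∣≤∣p∣+∣q∣ p q
∣p∪q∣≤∣p∣+∣q∣ (true ∷ p) (t ∷ q) = s≤s (≤-trans (∣p∪q∣≤∣p∣+∣q∣ p q) (+-monoʳ-≤ ∣ p ∣ (∣p∣≤∣x∷p∣ t q)))
∣p∪q∣≤∣p∣+∣q∣ (false ∷ p) (true ∷ q) = ≤-trans (s≤s (∣p∪q∣≤∣p∣+∣q∣ p q)) (≤-reflexive (sym (+-suc ∣ p ∣ ∣ q ∣)))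

x∉p⇒∣p∪⁅x⁆∣≡1+∣p∣ : ∀ {x : Fin n} (p : Subset n) → x ∉ p → ∣ p ∪ ⁅ x ⁆ ∣ ≡ suc ∣ p ∣
x∉p⇒∣p∪⁅x⁆∣≡1+∣p∣ {x = zero} (false ∷ p) _ = cong (suc ∘ ∣_∣) (∪-identityʳ p)
x∉p⇒∣p∪⁅x⁆∣≡1+∣p∣ {x = zero} (true ∷ p) x∉p = contradiction here x∉p
x∉p⇒∣p∪⁅x⁆∣≡1+∣p∣ {x = suc x} (false ∷ p) x∉p = x∉p⇒∣p∪⁅x⁆∣≡1+∣p∣ p (x∉p ∘ there)
x∉p⇒∣p∪⁅x⁆∣≡1+∣p∣ {x = suc x} (true ∷ p) x∉p = cong suc (x∉p⇒∣p∪⁅x⁆∣≡1+∣p∣ p (x∉p ∘ there))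

0<∣p∣⇒nonempty : ∀ {p : Subset n} → 0 < ∣ p ∣ → Nonempty p
0<∣p∣⇒nonempty {n} {p} 0<∣p∣ with nonempty? p
... | yes p≢∅ = p≢∅
... | no p≡∅ = contradiction (trans (cong ∣_∣ (Empty-unique p≡∅)) (∣⊥∣≡0 n)) (≢-sym (<⇒≢ 0<∣p∣))

∈-tabulate⁺ : ∀ {f : Fin n → Side} {x} → f x ≡ inside → x ∈ tabulate f
∈-tabulate⁺ {f = f} {x} fx≡inside = lookup⇒[]= x (tabulate f) (trans (lookup∘tabulate f x) fx≡inside)

∈-tabulate⁻ : ∀ {f : Fin n → Side} {x} → x ∈ tabulate f → f x ≡ inside
∈-tabulate⁻ {f = f} {x} x∈ = trans (sym (lookup∘tabulate f x)) ([]=⇒lookup x∈)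

∈-tabulate-does⁺ : ∀ {P : Pred (Fin n) p} (P? : Decidable P) {x} → P x → x ∈ tabulate (does ∘ P?)
∈-tabulate-does⁺ P? {x} Px = ∈-tabulate⁺ (dec-true (P? x) Px)

∈-tabulate-does⁻ : ∀ {P : Pred (Fin n) p} (P? : Decidable P) {x} → x ∈ tabulate (does ∘ P?) → P x
∈-tabulate-does⁻ P? {x} x∈ with P? x | ∈-tabulate⁻ {f = does ∘ P?} x∈
... | yes Px | _ = Px
... | no _ | ()

¬n<2∣p∣⇒n≤2∣∁p∣ : ∀ (p : Subset n) → ¬ n < 2 * ∣ p ∣ → n ≤ 2 * ∣ ∁ p ∣
¬n<2∣p∣⇒n≤2∣∁p∣ {n} p ¬n<2∣p∣ = begin
  n               ≡⟨ ∣p∣+∣∁p∣≡n ⟨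
  ∣ p ∣ + ∣ ∁ p ∣ ≤⟨ +-monoˡ-≤ ∣ ∁ p ∣ ∣p∣≤∣∁p∣ ⟩
  ∣ ∁ p ∣ + ∣ ∁ p ∣ ≡⟨ cong (∣ ∁ p ∣ +_) (+-identityʳ ∣ ∁ p ∣) ⟨
  2 * ∣ ∁ p ∣     ∎
  where
  open ≤-Reasoning
  ∣p∣+∣∁p∣≡n : ∣ p ∣ + ∣ ∁ p ∣ ≡ n
  ∣p∣+∣∁p∣≡n = trans (cong (∣ p ∣ +_) (∣∁p∣≡n∸∣p∣ p)) (m+[n∸m]≡n (∣p∣≤n p))
  ∣p∣≤∣∁p∣ : ∣ p ∣ ≤ ∣ ∁ p ∣
  ∣p∣≤∣∁p∣ = +-cancelˡ-≤ ∣ p ∣ _ _ (begin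
    ∣ p ∣ + ∣ p ∣       ≡⟨ cong (∣ p ∣ +_) (+-identityʳ ∣ p ∣) ⟨
    2 * ∣ p ∣           ≤⟨ ≮⇒≥ ¬n<2∣p∣ ⟩
    n                   ≡⟨ ∣p∣+∣∁p∣≡n ⟨
    ∣ p ∣ + ∣ ∁ p ∣     ∎)

-- If every element of P has a predecessor in P, the walk backwards along
-- predecessors must revisit a vertex within n steps.
module _ {_~_ : Rel (Fin n) ℓ} {P : Pred (Fin n) p}
         (pred : ∀ {v} → P v → ∃ λ w → P w × w ~ v) {v₀ : Fin n} (Pv₀ : P v₀) where
  private
    walk′ : ℕ → Σ (Fin n) P
    walk′ zero = v₀ , Pv₀
    walk′ (suc m) = let w , Pw , _ = pred (proj₂ (walk′ m)) in w , Pw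

    walk : ℕ → Fin n
    walk = proj₁ ∘ walk′

    walk-step : ∀ m → walk (suc m) ~ walk m
    walk-step m = proj₂ (proj₂ (pred (proj₂ (walk′ m))))

    walk-reach : ∀ {i j} → i <′ j → TransClosure _~_ (walk j) (walk i)
    walk-reach {i} ≤′-refl = [ walk-step i ]
    walk-reach (≤′-step {j} i<j) = walk-step j ∷ walk-reach i<j

  predecessor-closed⇒cycle : ∃ λ v → TransClosure _~_ v v
  predecessor-closed⇒cycle
    with i , j , i<j , walkᵢ≡walkⱼ ← pigeonhole (n<1+n n) (walk ∘ toℕ)
    = walk (toℕ j) , subst (TransClosure _~_ (walk (toℕ j))) walkᵢ≡walkⱼ (walk-reach (≤⇒≤′ i<j))

outNbrs : Digraph n → Fin n → Subset n
outNbrs G u = tabulate (G u)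

closedOutNbrs : Digraph n → Fin n → Subset n
closedOutNbrs G v = ⁅ v ⁆ ∪ outNbrs G v

Independent : Digraph n → Subset n → Set
Independent G I = ∀ {x y} → x ∈ I → y ∈ I → ¬ Edge G x y

HasPredIn : Digraph n → Subset n → Fin n → Set
HasPredIn G R v = ∃ λ w → w ∈ R × Edge G w v

IsSourceIn : Digraph n → Subset n → Fin n → Set
IsSourceIn G R v = v ∈ R × ¬ HasPredIn G R v

hasPredIn? : ∀ (G : Digraph n) R → Decidable (HasPredIn G R)
hasPredIn? G R v = any? λ w → (w ∈? R) ×-dec (G w v Bool.≟ true)

acyclic⇒source : ∀ {G : Digraph n} {R} → Acyclic G → Nonempty R → ∃ (IsSourceIn G R)
acyclic⇒source {G = G} {R} acyclic (v₀ , v₀∈R) =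
  decidable-stable (any? λ v → (v ∈? R) ×-dec ¬? (hasPredIn? G R v)) no-source⇒cycle
  where
  no-source⇒cycle : ¬ ¬ ∃ (IsSourceIn G R)
  no-source⇒cycle no-source =
    let v , v⇝v = predecessor-closed⇒cycle pred v₀∈R in acyclic v v⇝v
    where
    pred : ∀ {v} → v ∈ R → HasPredIn G R v
    pred {v} v∈R = decidable-stable (hasPredIn? G R v) (λ ¬pred → no-source (v , v∈R , ¬pred))

hasEdge⇒¬independent : ∀ {G : Digraph n} {k I} → EveryKSetHasEdge G k → ∣ I ∣ ≡ k → ¬ Independent G I
hasEdge⇒¬independent hasEdge ∣I∣≡k I-indep =
  let _ , _ , x∈I , y∈I , x→y = hasEdge _ ∣I∣≡k in I-indep x∈I y∈I x→y

module _ {G : Digraph n} (acyclic : Acyclic G) where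

  add-source : ∀ {R I v} → IsSourceIn G R v → I ⊆ R ─ closedOutNbrs G v → Independent G I →
    I ∪ ⁅ v ⁆ ⊆ R × ∣ I ∪ ⁅ v ⁆ ∣ ≡ suc ∣ I ∣ × Independent G (I ∪ ⁅ v ⁆)
  add-source {R} {I} {v} (v∈R , v-source) I⊆R′ I-indep =
    I∪v⊆R , x∉p⇒∣p∪⁅x⁆∣≡1+∣p∣ I (v∉R′ ∘ I⊆R′) , I∪v-indep
    where
    I⊆R : I ⊆ R
    I⊆R = p─q⊆p R _ ∘ I⊆R′

    v∉R′ : v ∉ R ─ closedOutNbrs G v
    v∉R′ v∈R′ = x∈p─q⇒x∉q R _ v∈R′ (x∈p∪q⁺ (inj₁ (x∈⁅x⁆ v)))

    I∪v⊆R : I ∪ ⁅ v ⁆ ⊆ R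
    I∪v⊆R x∈ with x∈p∪q⁻ I ⁅ v ⁆ x∈
    ... | inj₁ x∈I = I⊆R x∈I
    ... | inj₂ x∈⁅v⁆ rewrite x∈⁅y⁆⇒x≡y v x∈⁅v⁆ = v∈R

    no-edge-into-v : ∀ {x} → x ∈ I → ¬ Edge G x v
    no-edge-into-v x∈I x→v = v-source (_ , I⊆R x∈I , x→v)

    no-edge-out-of-v : ∀ {y} → y ∈ I → ¬ Edge G v y
    no-edge-out-of-v y∈I v→y =
      x∈p─q⇒x∉q R _ (I⊆R′ y∈I) (x∈p∪q⁺ (inj₂ (∈-tabulate⁺ v→y)))

    I∪v-indep : Independent G (I ∪ ⁅ v ⁆)
    I∪v-indep {x} {y} x∈ y∈ with x∈p∪q⁻ I ⁅ v ⁆ x∈ | x∈p∪q⁻ I ⁅ v ⁆ y∈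
    ... | inj₁ x∈I | inj₁ y∈I = I-indep x∈I y∈I
    ... | inj₁ x∈I | inj₂ y∈⁅v⁆ rewrite x∈⁅y⁆⇒x≡y v y∈⁅v⁆ = no-edge-into-v x∈I
    ... | inj₂ x∈⁅v⁆ | inj₁ y∈I rewrite x∈⁅y⁆⇒x≡y v x∈⁅v⁆ = no-edge-out-of-v y∈I
    ... | inj₂ x∈⁅v⁆ | inj₂ y∈⁅v⁆ rewrite x∈⁅y⁆⇒x≡y v x∈⁅v⁆ | x∈⁅y⁆⇒x≡y v y∈⁅v⁆ = acyclic v ∘ [_]

  remove-closedOutNbrs : ∀ {c m v} (R : Subset n) → c * ∣ outNbrs G v ∣ ≤ m →
    c * ∣ R ∣ ≤ (c + m) + c * ∣ R ─ closedOutNbrs G v ∣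
  remove-closedOutNbrs {c} {m} {v} R deg≤ = begin
    c * ∣ R ∣                      ≤⟨ *-monoʳ-≤ c (∣p∣≤∣p─q∣+∣q∣ R N[v]) ⟩
    c * (∣ R′ ∣ + ∣ N[v] ∣)         ≤⟨ *-monoʳ-≤ c (+-monoʳ-≤ ∣ R′ ∣ ∣N[v]∣≤1+∣N⁺v∣) ⟩
    c * (∣ R′ ∣ + (1 + ∣ N⁺v ∣))    ≡⟨ distrib c ∣ R′ ∣ ∣ N⁺v ∣ ⟩
    (c + c * ∣ N⁺v ∣) + c * ∣ R′ ∣  ≤⟨ +-monoˡ-≤ (c * ∣ R′ ∣) (+-monoʳ-≤ c deg≤) ⟩
    (c + m) + c * ∣ R′ ∣            ∎
    where
    open ≤-Reasoning
    N⁺v N[v] R′ : Subset n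
    N⁺v = outNbrs G v
    N[v] = closedOutNbrs G v
    R′ = R ─ N[v]
    ∣N[v]∣≤1+∣N⁺v∣ : ∣ N[v] ∣ ≤ 1 + ∣ N⁺v ∣
    ∣N[v]∣≤1+∣N⁺v∣ = ≤-trans (∣p∪q∣≤∣p∣+∣q∣ ⁅ v ⁆ N⁺v) (≤-reflexive (cong (_+ ∣ N⁺v ∣) (∣⁅x⁆∣≡1 v)))
    distrib : ∀ c a b → c * (a + (1 + b)) ≡ (c + c * b) + c * a
    distrib = solve-∀

  -- The out-degree bound m/c is kept as the pair c, m to stay in ℕ; each round
  -- removes at most (c + m)/c vertices from R.
  greedy-independent : ∀ {c m} → 0 < c → ∀ t (R : Subset n) →
    (∀ {u} → u ∈ R → c * ∣ outNbrs G u ∣ ≤ m) → t * (c + m) ≤ c * ∣ R ∣ →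
    ∃ λ I → I ⊆ R × ∣ I ∣ ≡ t × Independent G I
  greedy-independent _ zero R _ _ = ⊥ , ⊆-min R , ∣⊥∣≡0 n , λ x∈⊥ → contradiction x∈⊥ ∉⊥
  greedy-independent {c} {m} 0<c (suc t) R deg≤ budget =
    let v , v-source = acyclic⇒source acyclic (0<∣p∣⇒nonempty 0<∣R∣) in pick v-source
    where
    0<∣R∣ : 0 < ∣ R ∣
    0<∣R∣ = *-cancelˡ-< c 0 ∣ R ∣ (begin-strict
      c * 0            ≡⟨ *-zeroʳ c ⟩
      0                <⟨ 0<c ⟩
      c                ≤⟨ m≤m+n c m ⟩
      c + m            ≤⟨ m≤m+n (c + m) (t * (c + m)) ⟩
      suc t * (c + m)  ≤⟨ budget ⟩
      c * ∣ R ∣        ∎)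
      where open ≤-Reasoning

    pick : ∀ {v} → IsSourceIn G R v → ∃ λ I → I ⊆ R × ∣ I ∣ ≡ suc t × Independent G I
    pick {v} v-source@(v∈R , _) =
      let I , I⊆R′ , ∣I∣≡t , I-indep = greedy-independent 0<c t (R ─ closedOutNbrs G v)
            (deg≤ ∘ p─q⊆p R _)
            (+-cancelˡ-≤ (c + m) _ _ (≤-trans budget (remove-closedOutNbrs {c} R (deg≤ v∈R))))
          I∪v⊆R , ∣I∪v∣≡1+∣I∣ , I∪v-indep = add-source v-source I⊆R′ I-indep
      in I ∪ ⁅ v ⁆ , I∪v⊆R , trans ∣I∪v∣≡1+∣I∣ (cong suc ∣I∣≡t) , I∪v-indep

heavy : Digraph n → ℕ → Subset n
heavy {n} G c = tabulate λ u → does (n ≤? c * ∣ outNbrs G u ∣)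

∈-heavy⁻ : ∀ {G : Digraph n} {c u} → u ∈ heavy G c → n ≤ c * ∣ outNbrs G u ∣
∈-heavy⁻ {n} {G} {c} = ∈-tabulate-does⁻ (λ u → n ≤? c * ∣ outNbrs G u ∣)

∈-∁heavy⁻ : ∀ {G : Digraph n} {c u} → u ∈ ∁ (heavy G c) → c * ∣ outNbrs G u ∣ < n
∈-∁heavy⁻ {n} {G} {c} u∈∁heavy =
  ≰⇒> (x∈∁p⇒x∉p u∈∁heavy ∘ ∈-tabulate-does⁺ (λ u → n ≤? c * ∣ outNbrs G u ∣))

light-budget : ∀ {k n b} → 6 * k ≤ n → n ≤ 2 * b → k * (3 * k + n) ≤ 3 * k * b
light-budget {k} {n} {b} 6k≤n n≤2b = begin
  k * (3 * k + n) ≤⟨ *-monoʳ-≤ k (*-cancelˡ-≤ 2 2[3k+n]≤2[3b]) ⟩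
  k * (3 * b)     ≡⟨ *-assoc-swap k b ⟩
  3 * k * b       ∎
  where
  open ≤-Reasoning
  2[3k+n]≤2[3b] : 2 * (3 * k + n) ≤ 2 * (3 * b)
  2[3k+n]≤2[3b] = begin
    2 * (3 * k + n) ≡⟨ expand k n ⟩
    6 * k + 2 * n   ≤⟨ +-monoˡ-≤ (2 * n) 6k≤n ⟩
    n + 2 * n       ≡⟨ collect n ⟩
    3 * n           ≤⟨ *-monoʳ-≤ 3 n≤2b ⟩
    3 * (2 * b)     ≡⟨ *-swap b ⟩
    2 * (3 * b)     ∎
    where
    expand : ∀ k n → 2 * (3 * k + n) ≡ 6 * k + 2 * n
    expand = solve-∀
    collect : ∀ n → n + 2 * n ≡ 3 * n
    collect = solve-∀
    *-swap : ∀ b → 3 * (2 * b) ≡ 2 * (3 * b)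
    *-swap = solve-∀
  *-assoc-swap : ∀ k b → k * (3 * b) ≡ 3 * k * b
  *-assoc-swap = solve-∀

heavy-majority : ∀ {G : Digraph n} {k} → 0 < k → 6 * k ≤ n → Acyclic G → EveryKSetHasEdge G k →
  n < 2 * ∣ heavy G (3 * k) ∣
heavy-majority {n} {G} {k} 0<k 6k≤n acyclic hasEdge =
  decidable-stable (n <? 2 * ∣ heavy G (3 * k) ∣) λ few-heavy →
    let _ , _ , ∣I∣≡k , I-indep =
          greedy-independent acyclic (*-monoʳ-< 3 0<k) k (∁ (heavy G (3 * k)))
            (<⇒≤ ∘ ∈-∁heavy⁻ {c = 3 * k})
            (light-budget {k} 6k≤n (¬n<2∣p∣⇒n≤2∣∁p∣ (heavy G (3 * k)) few-heavy))
    in hasEdge⇒¬independent hasEdge ∣I∣≡k I-indep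

heavy-out-neighbourhoods : ∀ {G : Digraph n} {k} → 0 < k → 6 * k ≤ n → Acyclic G → EveryKSetHasEdge G k →
  Σ (Subset n) λ X → Σ (Fin n → Subset n) λ S₊ →
      n < 2 * ∣ X ∣
    × (∀ u → u ∈ X → n ≤ 3 * k * ∣ S₊ u ∣)
    × (∀ u x → x ∈ S₊ u → Reach G u x)
heavy-out-neighbourhoods {G = G} {k} 0<k 6k≤n acyclic hasEdge =
  heavy G (3 * k) , outNbrs G , heavy-majority 0<k 6k≤n acyclic hasEdge ,
  (λ _ → ∈-heavy⁻ {c = 3 * k}) , λ _ _ x∈S₊u → [ ∈-tabulate⁻ x∈S₊u ]

transpose : Digraph n → Digraph n
transpose G u v = G v u

reach-transpose⁻ : ∀ {G : Digraph n} {x y} → Reach (transpose G) x y → Reach G y x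
reach-transpose⁻ [ y→x ] = [ y→x ]
reach-transpose⁻ (z→x ∷ y⇝z) = reach-transpose⁻ y⇝z ∷ʳ z→x

acyclic-transpose : ∀ {G : Digraph n} → Acyclic G → Acyclic (transpose G)
acyclic-transpose acyclic v = acyclic v ∘ reach-transpose⁻

hasEdge-transpose : ∀ {G : Digraph n} {k} → EveryKSetHasEdge G k → EveryKSetHasEdge (transpose G) k
hasEdge-transpose hasEdge S ∣S∣≡k =
  let x , y , x∈S , y∈S , x→y = hasEdge S ∣S∣≡k in y , x , y∈S , x∈S , x→y

lemma4p2 : (k n : ℕ) → 0 < k → 10 * k < n →
    (G : Digraph n) → Acyclic G → EveryKSetHasEdge G k →
    (Σ (Subset n) λ X → Σ (Fin n → Subset n) λ S₊ →
        n < 2 * ∣ X ∣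
      × (∀ u → u ∈ X → n ≤ 3 * k * ∣ S₊ u ∣)
      × (∀ u x → x ∈ S₊ u → Reach G u x))
    × (Σ (Subset n) λ X′ → Σ (Fin n → Subset n) λ S₋ →
        n < 2 * ∣ X′ ∣
      × (∀ u → u ∈ X′ → n ≤ 3 * k * ∣ S₋ u ∣)
      × (∀ u x → x ∈ S₋ u → Reach G x u))
lemma4p2 k n 0<k 10k<n G acyclic hasEdge =
  heavy-out-neighbourhoods 0<k 6k≤n acyclic hasEdge ,
  (let X′ , S₋ , majority , degree , reach =
         heavy-out-neighbourhoods 0<k 6k≤n (acyclic-transpose acyclic) (hasEdge-transpose hasEdge)
   in X′ , S₋ , majority , degree , λ u x → reach-transpose⁻ ∘ reach u x)
  where
  6k≤n : 6 * k ≤ n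
  6k≤n = ≤-trans (*-monoˡ-≤ k (m≤m+n 6 4)) (<⇒≤ 10k<n)
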